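{- Let $n\ge 0$. The simplicial complex $W_n$ has the following properties: (a) $W_n$ has dimension $n$. (b) The facets of $W_n$ are exactly the sets of the form $\{\vec{x}+\vec{e}_i\}_{i\in[n+1]}$ for $\vec{x}\in\mathbb{Z}^{n+1}$ with sum of coordinates $-1$ ("positive" facets), or $\{\vec{x}-\vec{e}_j\}_{j\in[n+1]}$ for $\vec{x}\in\mathbb{Z}^{n+1}$ with sum of coordinates $1$ ("negative" facets); here $\vec{e}_1,\dots,\vec{e}_{n+1}$ are the standard basis vectors of $\mathbb{R}^{n+1}$. (c) Each vertex of $W_n$ is contained in exactly $n+1$ positive facets and exactly $n+1$ negative facets. (d) Each face $F$ of $W_n$ is contained in a facet of $W_n$, and if $\dim F\ge 2$ this facet is unique.
   Context: For $n\ge 0$, $A_n=\{(x_1,\dots,x_{n+1})\in\mathbb{Z}^{n+1}:\sum_i x_i=0\}$, with metric $d(\vec{x},\vec{y})=\|\vec{x}-\vec{y}\|_1/2$. $W_n$ is the simplicial complex whose vertex set is $A_n$ and whose faces are the nonempty finite sets $F\subseteq A_n$ with $d(\vec{x},\vec{y})=1$ for all distinct $\vec{x},\vec{y}\in F$. $[m]=\{1,\dots,m\}$. -}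

module Defs where

open import Data.Nat as ℕ using (ℕ; zero; suc; _∸_; ⌊_/2⌋)
open import Data.Integer as ℤ using (ℤ; +_; -[1+_]; ∣_∣)
open import Data.Fin using (Fin; _≟_)
open import Data.Vec as Vec using (Vec; tabulate; zipWith; foldr′; toList)
open import Data.List as List using (List; []; length)
open import Data.List.Membership.Propositional using (_∈_)
open import Data.List.Relation.Unary.Unique.Propositional using (Unique)
open import Data.List.Relation.Unary.All using (All)
open import Data.List.Relation.Unary.Any using (Any)
open import Data.List.Relation.Unary.AllPairs using (AllPairs)
open import Data.Product using (Σ; ∃; _×_)
open import Data.Sum using (_⊎_)
open import Relation.Binary.PropositionalEquality using (_≡_; _≢_)
open import Relation.Nullary using (¬_; does)
open import Data.Bool using (if_then_else_)
open import Function.Bundles using (_⇔_)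

Pt : ℕ → Set
Pt n = Vec ℤ (suc n)

Σℤ : ∀ {n} → Pt n → ℤ
Σℤ = foldr′ ℤ._+_ (+ 0)

InA : ∀ {n} → Pt n → Set
InA x = Σℤ x ≡ + 0

l1 : ∀ {n} → Pt n → Pt n → ℕ
l1 x y = foldr′ ℕ._+_ 0 (zipWith (λ a b → ∣ a ℤ.- b ∣) x y)

dist : ∀ {n} → Pt n → Pt n → ℕ
dist x y = ⌊ l1 x y /2⌋

e : ∀ {n} → Fin (suc n) → Pt n
e i = tabulate (λ j → if does (i ≟ j) then + 1 else + 0)

_+ᵥ_ _-ᵥ_ : ∀ {n} → Pt n → Pt n → Pt n
x +ᵥ y = zipWith ℤ._+_ x y
x -ᵥ y = zipWith ℤ._-_ x y

-- Finite sets of points are represented by duplicate-free lists.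
-- A face of W_n: nonempty finite subset of A_n, pairwise distance 1.
IsFace : ∀ {n} → List (Pt n) → Set
IsFace {n} F =
  Unique F × (F ≢ []) × All InA F ×
  (∀ {x y} → x ∈ F → y ∈ F → x ≢ y → dist x y ≡ 1)

_⊆_ : ∀ {n} → List (Pt n) → List (Pt n) → Set
F ⊆ G = ∀ {x} → x ∈ F → x ∈ G

_≋_ : ∀ {n} → List (Pt n) → List (Pt n) → Set
F ≋ G = F ⊆ G × G ⊆ F

dim : ∀ {n} → List (Pt n) → ℕ
dim F = length F ∸ 1

IsFacet : ∀ {n} → List (Pt n) → Set
IsFacet F = IsFace F × (∀ G → IsFace G → F ⊆ G → G ⊆ F)

HasDimension : ℕ → ℕ → Set
HasDimension n k =
  (∀ (F : List (Pt n)) → IsFace F → dim F ℕ.≤ k) ×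
  (Σ (List (Pt n)) λ F → IsFace F × dim F ≡ k)

posSet negSet : ∀ {n} → Pt n → List (Pt n)
posSet x = toList (tabulate (λ i → x +ᵥ e i))
negSet x = toList (tabulate (λ j → x -ᵥ e j))

PosForm NegForm : ∀ {n} → List (Pt n) → Set
PosForm F = ∃ λ x → Σℤ x ≡ -[1+ 0 ] × F ≋ posSet x
NegForm F = ∃ λ x → Σℤ x ≡ + 1 × F ≋ negSet x

PositiveFacet NegativeFacet : ∀ {n} → List (Pt n) → Set
PositiveFacet F = IsFacet F × PosForm F
NegativeFacet F = IsFacet F × NegForm F

ExactlyK : ∀ {n} → ℕ → (List (Pt n) → Set) → Set
ExactlyK {n} k P = Σ (List (List (Pt n))) λ L →
  length L ≡ k × All P L × AllPairs (λ F G → ¬ (F ≋ G)) L ×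
  (∀ F → P F → Any (F ≋_) L)

{-# OPTIONS --safe #-}
module Submission where

-- Order ℤⁿ⁺¹ coordinatewise.  For x, y ∈ A_n one has d(x, y) = Σx − Σ(x ∧ y),
-- so adjacency says that x covers the meet x ∧ y, or equivalently that x is
-- covered by the join x ∨ y.  The positive simplex {p + eᵢ} is the set of
-- covers of p and the negative simplex {q − eⱼ} the set of elements covered
-- by q.  For an edge {v, w} of a face, a triangle argument in this
-- distributive lattice shows that either every vertex lies above v ∧ w or
-- every vertex lies below v ∨ w; hence each face sits in a positive or a
-- negative simplex, and these (having n + 1 vertices) are the facets.  Two
-- distinct covers of p meet in p and two distinct elements covered by q join
-- in q, which pins down the facet through an edge of a given kind; three
-- vertices cannot lie in simplices of both kinds, since relative complements
-- in a distributive lattice are unique.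

open import Defs
open import Data.Nat as ℕ using (ℕ; zero; suc; _≤_; z≤n; s≤s)
import Data.Nat.Properties as ℕP
open import Data.Integer as ℤ using (ℤ; +_; -[1+_]; _+_; _-_; -_; _⊓_; _⊔_; ∣_∣; +≤+)
import Data.Integer.Properties as ℤP
open import Data.Integer.Tactic.RingSolver using (solve-∀)
open import Algebra.Properties.AbelianGroup ℤP.+-0-abelianGroup using (∙-cancelˡ; ∙-cancelʳ)
open import Data.Fin using (Fin; zero; suc)
open import Data.Vec as Vec using (Vec; []; _∷_; zipWith; foldr′; toList)
import Data.Vec.Properties as Vecₚ
open import Data.Vec.Relation.Binary.Pointwise.Inductive as Pw using (Pointwise; []; _∷_)
open import Data.List as List using (List; []; _∷_; length)
open import Data.List.Membership.Propositional using (_∈_; find)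
open import Data.List.Membership.Propositional.Properties using (∈-tabulate⁺; ∈-tabulate⁻)
import Data.List.Properties as Listₚ
open import Data.List.Relation.Binary.Subset.Propositional.Properties using (⊆[]⇒≡[])
open import Data.List.Relation.Unary.All as All using (All; []; _∷_)
import Data.List.Relation.Unary.All.Properties as Allₚ
open import Data.List.Relation.Unary.Any using (Any; here; there)
import Data.List.Relation.Unary.Any.Properties as Anyₚ
import Data.List.Relation.Unary.AllPairs.Properties as AllPairsₚ
open import Data.List.Relation.Unary.AllPairs using ([]; _∷_)
open import Data.List.Relation.Unary.Unique.Propositional using (Unique)
import Data.List.Relation.Unary.Unique.Propositional.Properties as Uniqueₚ
open import Data.Product using (Σ; ∃; _×_; _,_; proj₁; proj₂)
open import Data.Sum using (_⊎_; inj₁; inj₂; [_,_]′)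
open import Data.Empty using (⊥; ⊥-elim)
open import Function using (_∘_; id; _⇔_; mk⇔; Equivalence)
open Equivalence using (to; from)
open import Relation.Binary.PropositionalEquality
open import Relation.Binary.Definitions using (Decidable; DecidableEquality)
open import Relation.Nullary using (¬_; yes; no)
open import Relation.Nullary.Decidable using (decidable-stable)

private
  variable
    m : ℕ
    A B C : Set

i⊓j+i⊔j≡i+j : ∀ i j → (i ⊓ j) + (i ⊔ j) ≡ i + j
i⊓j+i⊔j≡i+j i j with ℤP.≤-total i j
... | inj₁ i≤j = cong₂ _+_ (ℤP.i≤j⇒i⊓j≡i i≤j) (ℤP.i≤j⇒i⊔j≡j i≤j)
... | inj₂ j≤i = trans (cong₂ _+_ (ℤP.i≥j⇒i⊓j≡j j≤i) (ℤP.i≥j⇒i⊔j≡i j≤i)) (ℤP.+-comm j i)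

+-≤-≡⇒≡ : ∀ {a b c d} → a ℤ.≤ b → c ℤ.≤ d → a + c ≡ b + d → a ≡ b × c ≡ d
+-≤-≡⇒≡ {a} {b} a≤b c≤d eq with a ℤP.≟ b
... | yes refl = refl , ∙-cancelˡ a _ _ eq
... | no a≢b   = ⊥-elim (ℤP.<-irrefl eq (ℤP.+-mono-<-≤ (ℤP.≤∧≢⇒< a≤b a≢b) c≤d))

ℤ-suc-injective : ∀ {i j} → ℤ.suc i ≡ ℤ.suc j → i ≡ j
ℤ-suc-injective {i} {j} = ∙-cancelˡ (+ 1) i j

suc[i]-i≡1 : ∀ i → (+ 1 + i) - i ≡ + 1
suc[i]-i≡1 = solve-∀

-- Integer vectors as a lattice

-- Σℤ, _+ᵥ_ and _-ᵥ_ of Defs are Σᵥ, zipWith _+_ and zipWith _-_ at length suc n.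
Σᵥ : Vec ℤ m → ℤ
Σᵥ = foldr′ _+_ (+ 0)

-- A tabulation, so that e zero is definitionally + 1 ∷ 0ᵥ.
0ᵥ : Vec ℤ m
0ᵥ = Vec.tabulate (λ _ → + 0)

infixr 7 _∧ᵥ_
infixr 6 _∨ᵥ_
infix 4 _≤ᵥ_ _≤ᵥ?_ _≟ᵥ_

_∧ᵥ_ _∨ᵥ_ : Vec ℤ m → Vec ℤ m → Vec ℤ m
_∧ᵥ_ = zipWith _⊓_
_∨ᵥ_ = zipWith _⊔_

_≤ᵥ_ : Vec ℤ m → Vec ℤ m → Set
_≤ᵥ_ = Pointwise ℤ._≤_

≤ᵥ-refl : {x : Vec ℤ m} → x ≤ᵥ x
≤ᵥ-refl = Pw.refl ℤP.≤-refl

≤ᵥ-trans : {x y z : Vec ℤ m} → x ≤ᵥ y → y ≤ᵥ z → x ≤ᵥ z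
≤ᵥ-trans = Pw.trans ℤP.≤-trans

_≤ᵥ?_ : Decidable (_≤ᵥ_ {m})
_≤ᵥ?_ = Pw.decidable ℤ._≤?_

_≟ᵥ_ : Decidable (_≡_ {A = Vec ℤ m})
_≟ᵥ_ = Vecₚ.≡-dec ℤP._≟_

x∧ᵥy≤ᵥx : (x y : Vec ℤ m) → x ∧ᵥ y ≤ᵥ x
x∧ᵥy≤ᵥx []       []       = []
x∧ᵥy≤ᵥx (a ∷ x) (b ∷ y) = ℤP.i⊓j≤i a b ∷ x∧ᵥy≤ᵥx x y

x∧ᵥy≤ᵥy : (x y : Vec ℤ m) → x ∧ᵥ y ≤ᵥ y
x∧ᵥy≤ᵥy []       []       = []
x∧ᵥy≤ᵥy (a ∷ x) (b ∷ y) = ℤP.i⊓j≤j a b ∷ x∧ᵥy≤ᵥy x y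

∧ᵥ-glb : {x y z : Vec ℤ m} → z ≤ᵥ x → z ≤ᵥ y → z ≤ᵥ x ∧ᵥ y
∧ᵥ-glb []       []       = []
∧ᵥ-glb (p ∷ ps) (q ∷ qs) = ℤP.⊓-glb p q ∷ ∧ᵥ-glb ps qs

x≤ᵥx∨ᵥy : (x y : Vec ℤ m) → x ≤ᵥ x ∨ᵥ y
x≤ᵥx∨ᵥy []       []       = []
x≤ᵥx∨ᵥy (a ∷ x) (b ∷ y) = ℤP.i≤i⊔j a b ∷ x≤ᵥx∨ᵥy x y

y≤ᵥx∨ᵥy : (x y : Vec ℤ m) → y ≤ᵥ x ∨ᵥ y
y≤ᵥx∨ᵥy []       []       = []
y≤ᵥx∨ᵥy (a ∷ x) (b ∷ y) = ℤP.i≤j⊔i a b ∷ y≤ᵥx∨ᵥy x y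

∨ᵥ-lub : {x y z : Vec ℤ m} → x ≤ᵥ z → y ≤ᵥ z → x ∨ᵥ y ≤ᵥ z
∨ᵥ-lub []       []       = []
∨ᵥ-lub (p ∷ ps) (q ∷ qs) = ℤP.⊔-lub p q ∷ ∨ᵥ-lub ps qs

zipWith-cancelˡ : (f : A → B → C) → (∀ a b c → f a b ≡ f a c → b ≡ c) →
                  (xs : Vec A m) {ys zs : Vec B m} → zipWith f xs ys ≡ zipWith f xs zs → ys ≡ zs
zipWith-cancelˡ f cancel []       {[]}     {[]}     _  = refl
zipWith-cancelˡ f cancel (x ∷ xs) {y ∷ ys} {z ∷ zs} eq =
  cong₂ _∷_ (cancel x y z (Vecₚ.∷-injectiveˡ eq)) (zipWith-cancelˡ f cancel xs (Vecₚ.∷-injectiveʳ eq))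

zipWith-cancelʳ : (f : A → B → C) → (∀ b a c → f a b ≡ f c b → a ≡ c) →
                  {xs zs : Vec A m} (ys : Vec B m) → zipWith f xs ys ≡ zipWith f zs ys → xs ≡ zs
zipWith-cancelʳ f cancel {[]}     {[]}     []       _  = refl
zipWith-cancelʳ f cancel {x ∷ xs} {z ∷ zs} (y ∷ ys) eq =
  cong₂ _∷_ (cancel y x z (Vecₚ.∷-injectiveˡ eq)) (zipWith-cancelʳ f cancel ys (Vecₚ.∷-injectiveʳ eq))

Σᵥ-0ᵥ : Σᵥ (0ᵥ {m}) ≡ + 0
Σᵥ-0ᵥ {zero}  = refl
Σᵥ-0ᵥ {suc m} = cong (λ s → + 0 + s) (Σᵥ-0ᵥ {m})

Σᵥ-zipWith-+ : (x y : Vec ℤ m) → Σᵥ (zipWith _+_ x y) ≡ Σᵥ x + Σᵥ y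
Σᵥ-zipWith-+ []      []      = refl
Σᵥ-zipWith-+ (a ∷ x) (b ∷ y) = begin
  (a + b) + Σᵥ (zipWith _+_ x y) ≡⟨ cong (_+_ (a + b)) (Σᵥ-zipWith-+ x y) ⟩
  (a + b) + (Σᵥ x + Σᵥ y)        ≡⟨ shuffle a b (Σᵥ x) (Σᵥ y) ⟩
  (a + Σᵥ x) + (b + Σᵥ y)        ∎
  where
  open ≡-Reasoning
  shuffle : ∀ a b s t → (a + b) + (s + t) ≡ (a + s) + (b + t)
  shuffle = solve-∀

Σᵥ-zipWith-minus : (x y : Vec ℤ m) → Σᵥ (zipWith _-_ x y) ≡ Σᵥ x - Σᵥ y
Σᵥ-zipWith-minus []      []      = refl
Σᵥ-zipWith-minus (a ∷ x) (b ∷ y) = begin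
  (a - b) + Σᵥ (zipWith _-_ x y) ≡⟨ cong (_+_ (a - b)) (Σᵥ-zipWith-minus x y) ⟩
  (a - b) + (Σᵥ x - Σᵥ y)        ≡⟨ shuffle a b (Σᵥ x) (Σᵥ y) ⟩
  (a + Σᵥ x) - (b + Σᵥ y)        ∎
  where
  open ≡-Reasoning
  shuffle : ∀ a b s t → (a - b) + (s - t) ≡ (a + s) - (b + t)
  shuffle = solve-∀

Σᵥ-mono-≤ : {x y : Vec ℤ m} → x ≤ᵥ y → Σᵥ x ℤ.≤ Σᵥ y
Σᵥ-mono-≤ []       = ℤP.≤-refl
Σᵥ-mono-≤ (p ∷ ps) = ℤP.+-mono-≤ p (Σᵥ-mono-≤ ps)

≤ᵥ∧Σᵥ≡⇒≡ : {x y : Vec ℤ m} → x ≤ᵥ y → Σᵥ x ≡ Σᵥ y → x ≡ y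
≤ᵥ∧Σᵥ≡⇒≡ []       _  = refl
≤ᵥ∧Σᵥ≡⇒≡ (p ∷ ps) eq =
  let a≡b , Σx≡Σy = +-≤-≡⇒≡ p (Σᵥ-mono-≤ ps) eq in cong₂ _∷_ a≡b (≤ᵥ∧Σᵥ≡⇒≡ ps Σx≡Σy)

∧ᵥ+∨ᵥ≡+ : (x y : Vec ℤ m) → zipWith _+_ (x ∧ᵥ y) (x ∨ᵥ y) ≡ zipWith _+_ x y
∧ᵥ+∨ᵥ≡+ []      []      = refl
∧ᵥ+∨ᵥ≡+ (a ∷ x) (b ∷ y) = cong₂ _∷_ (i⊓j+i⊔j≡i+j a b) (∧ᵥ+∨ᵥ≡+ x y)

Σᵥ∧ᵥ+Σᵥ∨ᵥ : (x y : Vec ℤ m) → Σᵥ (x ∧ᵥ y) + Σᵥ (x ∨ᵥ y) ≡ Σᵥ x + Σᵥ y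
Σᵥ∧ᵥ+Σᵥ∨ᵥ x y = begin
  Σᵥ (x ∧ᵥ y) + Σᵥ (x ∨ᵥ y)          ≡⟨ Σᵥ-zipWith-+ (x ∧ᵥ y) (x ∨ᵥ y) ⟨
  Σᵥ (zipWith _+_ (x ∧ᵥ y) (x ∨ᵥ y)) ≡⟨ cong Σᵥ (∧ᵥ+∨ᵥ≡+ x y) ⟩
  Σᵥ (zipWith _+_ x y)               ≡⟨ Σᵥ-zipWith-+ x y ⟩
  Σᵥ x + Σᵥ y                        ∎
  where open ≡-Reasoning

∧ᵥ-∨ᵥ-cancel : (x : Vec ℤ m) {y z : Vec ℤ m} → x ∧ᵥ y ≡ x ∧ᵥ z → x ∨ᵥ y ≡ x ∨ᵥ z → y ≡ z
∧ᵥ-∨ᵥ-cancel x {y} {z} ∧≡ ∨≡ = zipWith-cancelˡ _+_ ∙-cancelˡ x (begin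
  zipWith _+_ x y               ≡⟨ ∧ᵥ+∨ᵥ≡+ x y ⟨
  zipWith _+_ (x ∧ᵥ y) (x ∨ᵥ y) ≡⟨ cong₂ (zipWith _+_) ∧≡ ∨≡ ⟩
  zipWith _+_ (x ∧ᵥ z) (x ∨ᵥ z) ≡⟨ ∧ᵥ+∨ᵥ≡+ x z ⟩
  zipWith _+_ x z               ∎)
  where open ≡-Reasoning

≤ᵥ⇒0ᵥ≤ᵥ- : {x y : Vec ℤ m} → x ≤ᵥ y → 0ᵥ ≤ᵥ zipWith _-_ y x
≤ᵥ⇒0ᵥ≤ᵥ- []       = []
≤ᵥ⇒0ᵥ≤ᵥ- (p ∷ ps) = ℤP.i≤j⇒0≤j-i p ∷ ≤ᵥ⇒0ᵥ≤ᵥ- ps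

x≤ᵥx+d : (x : Vec ℤ m) {d : Vec ℤ m} → 0ᵥ ≤ᵥ d → x ≤ᵥ zipWith _+_ x d
x≤ᵥx+d []      {[]}          []           = []
x≤ᵥx+d (a ∷ x) {+ k ∷ d}     (_ ∷ d≥0)    = ℤP.i≤i+j a (+ k) ∷ x≤ᵥx+d x d≥0
x≤ᵥx+d (a ∷ x) { -[1+ k ] ∷ d} (() ∷ _)

x-d≤ᵥx : (x : Vec ℤ m) {d : Vec ℤ m} → 0ᵥ ≤ᵥ d → zipWith _-_ x d ≤ᵥ x
x-d≤ᵥx []      {[]}          []           = []
x-d≤ᵥx (a ∷ x) {+ k ∷ d}     (_ ∷ d≥0)    = ℤP.i-j≤i a (+ k) ∷ x-d≤ᵥx x d≥0
x-d≤ᵥx (a ∷ x) { -[1+ k ] ∷ d} (() ∷ _)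

x+[y-x]≡y : (x y : Vec ℤ m) → zipWith _+_ x (zipWith _-_ y x) ≡ y
x+[y-x]≡y []      []      = refl
x+[y-x]≡y (a ∷ x) (b ∷ y) = cong₂ _∷_ (identity a b) (x+[y-x]≡y x y)
  where
  identity : ∀ a b → a + (b - a) ≡ b
  identity = solve-∀

x-[x-y]≡y : (x y : Vec ℤ m) → zipWith _-_ x (zipWith _-_ x y) ≡ y
x-[x-y]≡y []      []      = refl
x-[x-y]≡y (a ∷ x) (b ∷ y) = cong₂ _∷_ (identity a b) (x-[x-y]≡y x y)
  where
  identity : ∀ a b → a - (a - b) ≡ b
  identity = solve-∀

-- The covering relation

infix 4 _⋖_

_⋖_ : Vec ℤ m → Vec ℤ m → Set
x ⋖ y = x ≤ᵥ y × Σᵥ y ≡ ℤ.suc (Σᵥ x)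

⋖-between : {x y z : Vec ℤ m} → x ≤ᵥ y → y ≤ᵥ z → x ⋖ z → x ≡ y ⊎ y ≡ z
⋖-between {x = x} {y} {z} x≤y y≤z (_ , Σz≡) with Σᵥ y ℤP.≟ Σᵥ x
... | yes Σy≡Σx = inj₁ (≤ᵥ∧Σᵥ≡⇒≡ x≤y (sym Σy≡Σx))
... | no  Σy≢Σx = inj₂ (≤ᵥ∧Σᵥ≡⇒≡ y≤z (ℤP.≤-antisym (Σᵥ-mono-≤ y≤z) Σz≤Σy))
  where
  Σz≤Σy : Σᵥ z ℤ.≤ Σᵥ y
  Σz≤Σy = subst (ℤ._≤ Σᵥ y) (sym Σz≡)
            (ℤP.i<j⇒suc[i]≤j (ℤP.≤∧≢⇒< (Σᵥ-mono-≤ x≤y) (Σy≢Σx ∘ sym)))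

⋖-meet : {p x y : Vec ℤ m} → p ⋖ x → p ⋖ y → x ≢ y → x ∧ᵥ y ≡ p
⋖-meet {x = x} {y} (p≤x , Σx≡) (p≤y , Σy≡) x≢y
  with ⋖-between (∧ᵥ-glb p≤x p≤y) (x∧ᵥy≤ᵥx x y) (p≤x , Σx≡)
... | inj₁ p≡x∧y = sym p≡x∧y
... | inj₂ x∧y≡x = ⊥-elim (x≢y (≤ᵥ∧Σᵥ≡⇒≡ x≤y (trans Σx≡ (sym Σy≡))))
  where
  x≤y : x ≤ᵥ y
  x≤y = subst (_≤ᵥ y) x∧y≡x (x∧ᵥy≤ᵥy x y)

⋖-join : {x y q : Vec ℤ m} → x ⋖ q → y ⋖ q → x ≢ y → x ∨ᵥ y ≡ q
⋖-join {x = x} {y} (x≤q , Σq≡x) (y≤q , Σq≡y) x≢y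
  with ⋖-between (x≤ᵥx∨ᵥy x y) (∨ᵥ-lub x≤q y≤q) (x≤q , Σq≡x)
... | inj₂ x∨y≡q = x∨y≡q
... | inj₁ x≡x∨y = ⊥-elim (x≢y (sym (≤ᵥ∧Σᵥ≡⇒≡ y≤x Σy≡Σx)))
  where
  y≤x : y ≤ᵥ x
  y≤x = subst (y ≤ᵥ_) (sym x≡x∨y) (y≤ᵥx∨ᵥy x y)
  Σy≡Σx : Σᵥ y ≡ Σᵥ x
  Σy≡Σx = ∙-cancelˡ (+ 1) _ _ (trans (sym Σq≡y) Σq≡x)

meet⋖ˡ⇒meet⋖ʳ : {x y : Vec ℤ m} → x ∧ᵥ y ⋖ x → Σᵥ x ≡ Σᵥ y → x ∧ᵥ y ⋖ y
meet⋖ˡ⇒meet⋖ʳ {x = x} {y} (_ , Σx≡) Σx≡Σy = x∧ᵥy≤ᵥy x y , trans (sym Σx≡Σy) Σx≡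

meet⋖⇔⋖join : {x y : Vec ℤ m} → Σᵥ x ≡ Σᵥ y → (x ∧ᵥ y ⋖ x) ⇔ (x ⋖ x ∨ᵥ y)
meet⋖⇔⋖join {x = x} {y} Σx≡Σy = mk⇔
  (λ (_ , Σx≡) → x≤ᵥx∨ᵥy x y , ∙-cancelˡ (Σᵥ (x ∧ᵥ y)) _ _ (begin
      Σᵥ (x ∧ᵥ y) + Σᵥ (x ∨ᵥ y)      ≡⟨ modular ⟩
      Σᵥ x + Σᵥ x                    ≡⟨ cong (_+ Σᵥ x) Σx≡ ⟩
      ℤ.suc (Σᵥ (x ∧ᵥ y)) + Σᵥ x     ≡⟨ shift (Σᵥ (x ∧ᵥ y)) (Σᵥ x) ⟩
      Σᵥ (x ∧ᵥ y) + ℤ.suc (Σᵥ x)     ∎))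
  (λ (_ , Σ∨≡) → x∧ᵥy≤ᵥx x y , sym (∙-cancelʳ (Σᵥ x) _ _ (begin
      ℤ.suc (Σᵥ (x ∧ᵥ y)) + Σᵥ x     ≡⟨ shift (Σᵥ (x ∧ᵥ y)) (Σᵥ x) ⟩
      Σᵥ (x ∧ᵥ y) + ℤ.suc (Σᵥ x)     ≡⟨ cong (_+_ (Σᵥ (x ∧ᵥ y))) Σ∨≡ ⟨
      Σᵥ (x ∧ᵥ y) + Σᵥ (x ∨ᵥ y)      ≡⟨ modular ⟩
      Σᵥ x + Σᵥ x                    ∎)))
  where
  open ≡-Reasoning
  modular : Σᵥ (x ∧ᵥ y) + Σᵥ (x ∨ᵥ y) ≡ Σᵥ x + Σᵥ x
  modular = trans (Σᵥ∧ᵥ+Σᵥ∨ᵥ x y) (cong (_+_ (Σᵥ x)) (sym Σx≡Σy))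
  shift : ∀ a s → (+ 1 + a) + s ≡ a + (+ 1 + s)
  shift = solve-∀

meet≤ᵥ⊎≤ᵥjoin : {u v w : Vec ℤ m} → Σᵥ u ≡ Σᵥ v → Σᵥ v ≡ Σᵥ w → v ≢ w →
                u ∧ᵥ v ⋖ u → u ∧ᵥ w ⋖ u → v ∧ᵥ w ≤ᵥ u ⊎ u ≤ᵥ v ∨ᵥ w
meet≤ᵥ⊎≤ᵥjoin {u = u} {v} {w} Σu≡Σv Σv≡Σw v≢w uv⋖u uw⋖u with (u ∧ᵥ v) ≟ᵥ (u ∧ᵥ w)
... | no uv≢uw = inj₂ (subst (_≤ᵥ v ∨ᵥ w) (⋖-join uv⋖u uw⋖u uv≢uw)
                   (∨ᵥ-lub (≤ᵥ-trans (x∧ᵥy≤ᵥy u v) (x≤ᵥx∨ᵥy v w))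
                           (≤ᵥ-trans (x∧ᵥy≤ᵥy u w) (y≤ᵥx∨ᵥy v w))))
... | yes uv≡uw with ⋖-between uv≤vw (x∧ᵥy≤ᵥx v w) (meet⋖ˡ⇒meet⋖ʳ uv⋖u Σu≡Σv)
  where
  uv≤vw : u ∧ᵥ v ≤ᵥ v ∧ᵥ w
  uv≤vw = ∧ᵥ-glb (x∧ᵥy≤ᵥy u v) (subst (_≤ᵥ w) (sym uv≡uw) (x∧ᵥy≤ᵥy u w))
...   | inj₁ uv≡vw = inj₁ (subst (_≤ᵥ u) uv≡vw (x∧ᵥy≤ᵥx u v))
...   | inj₂ vw≡v  = ⊥-elim (v≢w (≤ᵥ∧Σᵥ≡⇒≡ (subst (_≤ᵥ w) vw≡v (x∧ᵥy≤ᵥy v w)) Σv≡Σw))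

⋖-triangle-absurd : {p q a b c : Vec ℤ m} → a ≢ b → a ≢ c → b ≢ c →
                    p ⋖ a → p ⋖ b → p ⋖ c → a ⋖ q → b ⋖ q → c ⋖ q → ⊥
⋖-triangle-absurd {a = a} a≢b a≢c b≢c p⋖a p⋖b p⋖c a⋖q b⋖q c⋖q =
  b≢c (∧ᵥ-∨ᵥ-cancel a (trans (⋖-meet p⋖a p⋖b a≢b) (sym (⋖-meet p⋖a p⋖c a≢c)))
                      (trans (⋖-join a⋖q b⋖q a≢b) (sym (⋖-join a⋖q c⋖q a≢c))))

0ᵥ≤ᵥe : ∀ {n} (i : Fin (suc n)) → 0ᵥ ≤ᵥ e i
0ᵥ≤ᵥe {zero}  zero    = +≤+ z≤n ∷ []
0ᵥ≤ᵥe {suc n} zero    = +≤+ z≤n ∷ ≤ᵥ-refl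
0ᵥ≤ᵥe {suc n} (suc i) = ℤP.≤-refl ∷ 0ᵥ≤ᵥe i

Σℤ-e : ∀ {n} (i : Fin (suc n)) → Σℤ (e i) ≡ + 1
Σℤ-e {zero}  zero    = refl
Σℤ-e {suc n} zero    = cong (λ s → + 1 + s) (Σᵥ-0ᵥ {suc n})
Σℤ-e {suc n} (suc i) = cong (λ s → + 0 + s) (Σℤ-e i)

e-injective : ∀ {n} {i j : Fin (suc n)} → e i ≡ e j → i ≡ j
e-injective {zero}  {zero}  {zero}  _  = refl
e-injective {suc n} {zero}  {zero}  _  = refl
e-injective {suc n} {suc i} {suc j} eq = cong suc (e-injective (Vecₚ.∷-injectiveʳ eq))

nonneg∧Σ≡1⇒e : ∀ {n} {d : Pt n} → 0ᵥ ≤ᵥ d → Σℤ d ≡ + 1 → ∃ λ i → d ≡ e i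
nonneg∧Σ≡1⇒e {zero}  {a ∷ []}          _             Σd≡1 =
  zero , cong (_∷ []) (trans (sym (ℤP.+-identityʳ a)) Σd≡1)
nonneg∧Σ≡1⇒e {suc n} {+ zero ∷ d}      (_ ∷ d≥0)     Σd≡1 =
  let i , d≡eᵢ = nonneg∧Σ≡1⇒e d≥0 (trans (sym (ℤP.+-identityˡ (Σᵥ d))) Σd≡1)
  in  suc i , cong (+ 0 ∷_) d≡eᵢ
nonneg∧Σ≡1⇒e {suc n} {+ suc k ∷ d}     (_ ∷ d≥0)     Σd≡1 =
  let 1≡1+k , 0≡Σd = +-≤-≡⇒≡ (+≤+ (s≤s z≤n)) 0≤Σd (sym Σd≡1)
  in  zero , cong₂ _∷_ (sym 1≡1+k) (sym (≤ᵥ∧Σᵥ≡⇒≡ d≥0 (trans (Σᵥ-0ᵥ {suc n}) 0≡Σd)))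
  where
  0≤Σd : + 0 ℤ.≤ Σᵥ d
  0≤Σd = subst (ℤ._≤ Σᵥ d) (Σᵥ-0ᵥ {suc n}) (Σᵥ-mono-≤ d≥0)
nonneg∧Σ≡1⇒e {suc n} { -[1+ k ] ∷ d} (() ∷ _) _

-- The two kinds of simplices

toList∘tabulate : (f : Fin m → A) → toList (Vec.tabulate f) ≡ List.tabulate f
toList∘tabulate {zero}  f = refl
toList∘tabulate {suc m} f = cong (f zero ∷_) (toList∘tabulate (f ∘ suc))

module _ (f : Fin m → A) where

  ∈-toList-tabulate⁺ : ∀ i → f i ∈ toList (Vec.tabulate f)
  ∈-toList-tabulate⁺ i = subst (f i ∈_) (sym (toList∘tabulate f)) (∈-tabulate⁺ i)

  ∈-toList-tabulate⁻ : ∀ {y} → y ∈ toList (Vec.tabulate f) → ∃ λ i → y ≡ f i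
  ∈-toList-tabulate⁻ {y} y∈ = ∈-tabulate⁻ (subst (y ∈_) (toList∘tabulate f) y∈)

x⋖x+eᵢ : ∀ {n} (x : Pt n) i → x ⋖ x +ᵥ e i
x⋖x+eᵢ x i = x≤ᵥx+d x (0ᵥ≤ᵥe i) , (begin
  Σℤ (x +ᵥ e i)     ≡⟨ Σᵥ-zipWith-+ x (e i) ⟩
  Σℤ x + Σℤ (e i)   ≡⟨ cong (_+_ (Σℤ x)) (Σℤ-e i) ⟩
  Σℤ x + + 1        ≡⟨ ℤP.+-comm (Σℤ x) (+ 1) ⟩
  ℤ.suc (Σℤ x)      ∎)
  where open ≡-Reasoning

x-eᵢ⋖x : ∀ {n} (x : Pt n) i → x -ᵥ e i ⋖ x
x-eᵢ⋖x x i = x-d≤ᵥx x (0ᵥ≤ᵥe i) , sym (begin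
  ℤ.suc (Σℤ (x -ᵥ e i))   ≡⟨ cong ℤ.suc (Σᵥ-zipWith-minus x (e i)) ⟩
  ℤ.suc (Σℤ x - Σℤ (e i)) ≡⟨ cong (λ s → ℤ.suc (Σℤ x - s)) (Σℤ-e i) ⟩
  ℤ.suc (Σℤ x - + 1)      ≡⟨ suc[s-1]≡s (Σℤ x) ⟩
  Σℤ x                    ∎)
  where
  open ≡-Reasoning
  suc[s-1]≡s : ∀ s → + 1 + (s - + 1) ≡ s
  suc[s-1]≡s = solve-∀

⋖⇒y-x≡e : ∀ {n} {x y : Pt n} → x ⋖ y → ∃ λ i → y -ᵥ x ≡ e i
⋖⇒y-x≡e {x = x} {y} (x≤y , Σy≡) = nonneg∧Σ≡1⇒e (≤ᵥ⇒0ᵥ≤ᵥ- x≤y) (begin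
  Σℤ (y -ᵥ x)           ≡⟨ Σᵥ-zipWith-minus y x ⟩
  Σℤ y - Σℤ x           ≡⟨ cong (_- Σℤ x) Σy≡ ⟩
  ℤ.suc (Σℤ x) - Σℤ x   ≡⟨ suc[i]-i≡1 (Σℤ x) ⟩
  + 1                   ∎)
  where open ≡-Reasoning

∈posSet⇔ : ∀ {n} {p y : Pt n} → y ∈ posSet p ⇔ p ⋖ y
∈posSet⇔ {p = p} {y} = mk⇔
  (λ y∈ → let i , y≡p+eᵢ = ∈-toList-tabulate⁻ (λ i → p +ᵥ e i) y∈
          in  subst (p ⋖_) (sym y≡p+eᵢ) (x⋖x+eᵢ p i))
  (λ p⋖y → let i , y-p≡eᵢ = ⋖⇒y-x≡e p⋖y
           in  subst (_∈ posSet p) (trans (cong (p +ᵥ_) (sym y-p≡eᵢ)) (x+[y-x]≡y p y))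
                     (∈-toList-tabulate⁺ (λ i → p +ᵥ e i) i))

∈negSet⇔ : ∀ {n} {q y : Pt n} → y ∈ negSet q ⇔ y ⋖ q
∈negSet⇔ {q = q} {y} = mk⇔
  (λ y∈ → let i , y≡q-eᵢ = ∈-toList-tabulate⁻ (λ i → q -ᵥ e i) y∈
          in  subst (_⋖ q) (sym y≡q-eᵢ) (x-eᵢ⋖x q i))
  (λ y⋖q → let i , q-y≡eᵢ = ⋖⇒y-x≡e y⋖q
           in  subst (_∈ negSet q) (trans (cong (q -ᵥ_) (sym q-y≡eᵢ)) (x-[x-y]≡y q y))
                     (∈-toList-tabulate⁺ (λ i → q -ᵥ e i) i))

x+eᵢ-injective : ∀ {n} (x : Pt n) {i j} → x +ᵥ e i ≡ x +ᵥ e j → i ≡ j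
x+eᵢ-injective x eq = e-injective (zipWith-cancelˡ _+_ ∙-cancelˡ x eq)

x-eᵢ-injective : ∀ {n} (x : Pt n) {i j} → x -ᵥ e i ≡ x -ᵥ e j → i ≡ j
x-eᵢ-injective x eq = e-injective (zipWith-cancelˡ _-_ -cancelˡ x eq)
  where
  -cancelˡ : ∀ a b c → a - b ≡ a - c → b ≡ c
  -cancelˡ a b c eq = ℤP.neg-injective (∙-cancelˡ a (- b) (- c) eq)

-- Otherwise p + e₀ and p′ + e₀ would both be the join p ∨ p′.
posSet-injective : ∀ {n} {p p′ : Pt n} → posSet p ≋ posSet p′ → p ≡ p′
posSet-injective {p = p} {p′} (⊆ , ⊇) with p ≟ᵥ p′
... | yes p≡p′ = p≡p′
... | no  p≢p′ = zipWith-cancelʳ _+_ ∙-cancelʳ (e zero) (begin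
  p +ᵥ e zero   ≡⟨ ⋖-join (x⋖x+eᵢ p zero) p′⋖p+e₀ p≢p′ ⟨
  p ∨ᵥ p′       ≡⟨ ⋖-join p⋖p′+e₀ (x⋖x+eᵢ p′ zero) p≢p′ ⟩
  p′ +ᵥ e zero  ∎)
  where
  open ≡-Reasoning
  p′⋖p+e₀ : p′ ⋖ p +ᵥ e zero
  p′⋖p+e₀ = to ∈posSet⇔ (⊆ (from ∈posSet⇔ (x⋖x+eᵢ p zero)))
  p⋖p′+e₀ : p ⋖ p′ +ᵥ e zero
  p⋖p′+e₀ = to ∈posSet⇔ (⊇ (from ∈posSet⇔ (x⋖x+eᵢ p′ zero)))

negSet-injective : ∀ {n} {q q′ : Pt n} → negSet q ≋ negSet q′ → q ≡ q′
negSet-injective {q = q} {q′} (⊆ , ⊇) with q ≟ᵥ q′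
... | yes q≡q′ = q≡q′
... | no  q≢q′ = zipWith-cancelʳ _-_ (λ b a c → ∙-cancelʳ (- b) a c) (e zero) (begin
  q -ᵥ e zero   ≡⟨ ⋖-meet (x-eᵢ⋖x q zero) q-e₀⋖q′ q≢q′ ⟨
  q ∧ᵥ q′       ≡⟨ ⋖-meet q′-e₀⋖q (x-eᵢ⋖x q′ zero) q≢q′ ⟩
  q′ -ᵥ e zero  ∎)
  where
  open ≡-Reasoning
  q-e₀⋖q′ : q -ᵥ e zero ⋖ q′
  q-e₀⋖q′ = to ∈negSet⇔ (⊆ (from ∈negSet⇔ (x-eᵢ⋖x q zero)))
  q′-e₀⋖q : q′ -ᵥ e zero ⋖ q
  q′-e₀⋖q = to ∈negSet⇔ (⊇ (from ∈negSet⇔ (x-eᵢ⋖x q′ zero)))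

posSet-Unique : ∀ {n} (p : Pt n) → Unique (posSet p)
posSet-Unique p = subst Unique (sym (toList∘tabulate (λ i → p +ᵥ e i))) (Uniqueₚ.tabulate⁺ (x+eᵢ-injective p))

negSet-Unique : ∀ {n} (q : Pt n) → Unique (negSet q)
negSet-Unique q = subst Unique (sym (toList∘tabulate (λ i → q -ᵥ e i))) (Uniqueₚ.tabulate⁺ (x-eᵢ-injective q))

length-toList-tabulate : (f : Fin m → A) → length (toList (Vec.tabulate f)) ≡ m
length-toList-tabulate f = trans (cong length (toList∘tabulate f)) (Listₚ.length-tabulate f)

-- Distance

+∣i-j∣≡ : ∀ i j → + ∣ i - j ∣ ≡ (i - i ⊓ j) + (j - i ⊓ j)
+∣i-j∣≡ i j with ℤP.≤-total i j
... | inj₁ i≤j = begin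
  + ∣ i - j ∣              ≡⟨ ℤP.∣-∣-≤ i≤j ⟩
  j - i                    ≡⟨ identity i j ⟩
  (i - i) + (j - i)        ≡⟨ cong (λ m → (i - m) + (j - m)) (ℤP.i≤j⇒i⊓j≡i i≤j) ⟨
  (i - i ⊓ j) + (j - i ⊓ j) ∎
  where
  open ≡-Reasoning
  identity : ∀ i j → j - i ≡ (i - i) + (j - i)
  identity = solve-∀
... | inj₂ j≤i = begin
  + ∣ i - j ∣              ≡⟨ cong +_ (ℤP.∣i-j∣≡∣j-i∣ i j) ⟩
  + ∣ j - i ∣              ≡⟨ ℤP.∣-∣-≤ j≤i ⟩
  i - j                    ≡⟨ identity i j ⟩
  (i - j) + (j - j)        ≡⟨ cong (λ m → (i - m) + (j - m)) (ℤP.i≥j⇒i⊓j≡j j≤i) ⟨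
  (i - i ⊓ j) + (j - i ⊓ j) ∎
  where
  open ≡-Reasoning
  identity : ∀ i j → i - j ≡ (i - j) + (j - j)
  identity = solve-∀

-- The left-hand side is Defs' l1 at length suc n.
l1≡ : (x y : Vec ℤ m) → + foldr′ ℕ._+_ 0 (zipWith (λ a b → ∣ a - b ∣) x y)
                        ≡ (Σᵥ x - Σᵥ (x ∧ᵥ y)) + (Σᵥ y - Σᵥ (x ∧ᵥ y))
l1≡ []      []      = refl
l1≡ (a ∷ x) (b ∷ y) = begin
  + (∣ a - b ∣ ℕ.+ L)                                                   ≡⟨ ℤP.pos-+ ∣ a - b ∣ L ⟩
  + ∣ a - b ∣ + + L                                                     ≡⟨ cong₂ _+_ (+∣i-j∣≡ a b) (l1≡ x y) ⟩
  ((a - a ⊓ b) + (b - a ⊓ b)) + ((Σᵥ x - Σᵥ (x ∧ᵥ y)) + (Σᵥ y - Σᵥ (x ∧ᵥ y)))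
    ≡⟨ shuffle a b (a ⊓ b) (Σᵥ x) (Σᵥ y) (Σᵥ (x ∧ᵥ y)) ⟩
  ((a + Σᵥ x) - (a ⊓ b + Σᵥ (x ∧ᵥ y))) + ((b + Σᵥ y) - (a ⊓ b + Σᵥ (x ∧ᵥ y))) ∎
  where
  open ≡-Reasoning
  L : ℕ
  L = foldr′ ℕ._+_ 0 (zipWith (λ a b → ∣ a - b ∣) x y)
  shuffle : ∀ a b c s t u → ((a - c) + (b - c)) + ((s - u) + (t - u))
                            ≡ ((a + s) - (c + u)) + ((b + t) - (c + u))
  shuffle = solve-∀

+dist≡ : ∀ {n} {x y : Pt n} → Σℤ x ≡ Σℤ y → + dist x y ≡ Σℤ x - Σℤ (x ∧ᵥ y)
+dist≡ {x = x} {y} Σx≡Σy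
  with Σℤ x - Σℤ (x ∧ᵥ y) | ℤP.i≤j⇒0≤j-i (Σᵥ-mono-≤ (x∧ᵥy≤ᵥx x y)) | l1≡k+k
  where
  l1≡k+k : + l1 x y ≡ (Σℤ x - Σℤ (x ∧ᵥ y)) + (Σℤ x - Σℤ (x ∧ᵥ y))
  l1≡k+k = trans (l1≡ x y) (cong (λ s → (Σℤ x - Σℤ (x ∧ᵥ y)) + (s - Σℤ (x ∧ᵥ y))) (sym Σx≡Σy))
... | + k | _ | l1≡k+k = cong +_ (trans (cong ℕ.⌊_/2⌋ (ℤP.+-injective l1≡k+k)) (sym (ℕP.n≡⌊n+n/2⌋ k)))

dist≡1⇔meet⋖ : ∀ {n} {x y : Pt n} → Σℤ x ≡ Σℤ y → dist x y ≡ 1 ⇔ x ∧ᵥ y ⋖ x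
dist≡1⇔meet⋖ {x = x} {y} Σx≡Σy = mk⇔
  (λ d≡1 → x∧ᵥy≤ᵥx x y , (begin
     Σℤ x                                    ≡⟨ identity (Σℤ x) (Σℤ (x ∧ᵥ y)) ⟩
     (Σℤ x - Σℤ (x ∧ᵥ y)) + Σℤ (x ∧ᵥ y)      ≡⟨ cong (_+ Σℤ (x ∧ᵥ y)) (k≡1 d≡1) ⟩
     + 1 + Σℤ (x ∧ᵥ y)                       ∎))
  (λ (_ , Σx≡) → ℤP.+-injective (begin
     + dist x y                              ≡⟨ +dist≡ {x = x} {y} Σx≡Σy ⟩
     Σℤ x - Σℤ (x ∧ᵥ y)                      ≡⟨ cong (_- Σℤ (x ∧ᵥ y)) Σx≡ ⟩
     ℤ.suc (Σℤ (x ∧ᵥ y)) - Σℤ (x ∧ᵥ y)       ≡⟨ suc[i]-i≡1 (Σℤ (x ∧ᵥ y)) ⟩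
     + 1                                     ∎))
  where
  open ≡-Reasoning
  identity : ∀ s t → s ≡ (s - t) + t
  identity = solve-∀
  k≡1 : dist x y ≡ 1 → Σℤ x - Σℤ (x ∧ᵥ y) ≡ + 1
  k≡1 d≡1 = trans (sym (+dist≡ {x = x} {y} Σx≡Σy)) (cong +_ d≡1)

module _ {A : Set} where

  ∈⇒≢[] : {x : A} {xs : List A} → x ∈ xs → xs ≢ []
  ∈⇒≢[] {xs = []}    ()
  ∈⇒≢[] {xs = _ ∷ _} _ ()

  remove : {x : A} {ys : List A} → x ∈ ys →
           ∃ λ ys′ → length ys ≡ suc (length ys′) × (∀ {y} → y ∈ ys → y ≢ x → y ∈ ys′)
  remove {ys = y ∷ ys} (here refl) = ys , refl , λ where
    (here refl) y≢y → ⊥-elim (y≢y refl)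
    (there y∈ys) _  → y∈ys
  remove {ys = y ∷ ys} (there x∈ys) =
    let ys′ , len , keep = remove x∈ys in
    y ∷ ys′ , cong suc len , λ where
      (here refl)   _   → here refl
      (there z∈ys) z≢x → there (keep z∈ys z≢x)

  Unique⇒length≤ : {xs ys : List A} → Unique xs → (∀ {x} → x ∈ xs → x ∈ ys) → length xs ≤ length ys
  Unique⇒length≤ {[]}     _              _  = z≤n
  Unique⇒length≤ {x ∷ xs} (x∉xs ∷ xs-uniq) xs⊆ys =
    let ys′ , len , keep = remove (xs⊆ys (here refl)) in
    subst (suc (length xs) ≤_) (sym len)
      (s≤s (Unique⇒length≤ xs-uniq λ z∈xs → keep (xs⊆ys (there z∈xs)) (λ z≡x → All.lookup x∉xs z∈xs (sym z≡x))))

  Unique∧length≥⇒⊇ : DecidableEquality A → {xs ys : List A} → Unique xs → (∀ {x} → x ∈ xs → x ∈ ys) →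
                     length ys ≤ length xs → ∀ {y} → y ∈ ys → y ∈ xs
  Unique∧length≥⇒⊇ _≟_ {xs} {ys} xs-uniq xs⊆ys len {y} y∈ys with y ∈? xs
    where open import Data.List.Membership.DecPropositional _≟_ using (_∈?_)
  ... | yes y∈xs = y∈xs
  ... | no  y∉xs = ⊥-elim (ℕP.<-irrefl refl (ℕP.≤-trans (Unique⇒length≤ yxs-uniq yxs⊆ys) len))
    where
    yxs-uniq : Unique (y ∷ xs)
    yxs-uniq = All.tabulate (λ x∈xs y≡x → y∉xs (subst (_∈ xs) (sym y≡x) x∈xs)) ∷ xs-uniq
    yxs⊆ys : ∀ {x} → x ∈ y ∷ xs → x ∈ ys
    yxs⊆ys (here refl) = y∈ys
    yxs⊆ys (there x∈xs) = xs⊆ys x∈xs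

-- Faces of W_n

module _ {n : ℕ} where

  private
    variable
      F G H : List (Pt n)
      a b c p q u u′ v w x y : Pt n

  face-InA : IsFace F → x ∈ F → InA x
  face-InA (_ , _ , F-InA , _) = All.lookup F-InA

  face-level : IsFace F → x ∈ F → y ∈ F → Σℤ x ≡ Σℤ y
  face-level F-face x∈F y∈F = trans (face-InA F-face x∈F) (sym (face-InA F-face y∈F))

  face-meet⋖ : IsFace F → x ∈ F → y ∈ F → x ≢ y → x ∧ᵥ y ⋖ x
  face-meet⋖ F-face@(_ , _ , _ , adjacent) x∈F y∈F x≢y =
    to (dist≡1⇔meet⋖ (face-level F-face x∈F y∈F)) (adjacent x∈F y∈F x≢y)

  face-⋖join : IsFace F → x ∈ F → y ∈ F → x ≢ y → x ⋖ x ∨ᵥ y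
  face-⋖join F-face x∈F y∈F x≢y =
    to (meet⋖⇔⋖join (face-level F-face x∈F y∈F)) (face-meet⋖ F-face x∈F y∈F x≢y)

  face-triangle : IsFace F → u ∈ F → v ∈ F → w ∈ F → v ≢ w → v ∧ᵥ w ≤ᵥ u ⊎ u ≤ᵥ v ∨ᵥ w
  face-triangle {u = u} {v} {w} F-face u∈F v∈F w∈F v≢w with u ≟ᵥ v | u ≟ᵥ w
  ... | yes refl | _        = inj₁ (x∧ᵥy≤ᵥx v w)
  ... | no  _    | yes refl = inj₁ (x∧ᵥy≤ᵥy v w)
  ... | no  u≢v  | no  u≢w  =
    meet≤ᵥ⊎≤ᵥjoin (face-level F-face u∈F v∈F) (face-level F-face v∈F w∈F) v≢w
                  (face-meet⋖ F-face u∈F v∈F u≢v) (face-meet⋖ F-face u∈F w∈F u≢w)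

  -- Necessarily v ∧ w ≤ u and u′ ≤ v ∨ w; the triangle (u; v, u′) then forces v ≤ u or u ≤ v ∨ w.
  face-no-crossing : IsFace F → v ∈ F → w ∈ F → v ≢ w → u ∈ F → u′ ∈ F →
                     ¬ (v ∧ᵥ w ≤ᵥ u′) → ¬ (u ≤ᵥ v ∨ᵥ w) → ⊥
  face-no-crossing {v = v} {w} {u} {u′} F-face v∈F w∈F v≢w u∈F u′∈F vw≰u′ u≰v∨w =
    [ vu′≤u-absurd , u≤v∨u′-absurd ]′ (face-triangle F-face u∈F v∈F u′∈F v≢u′)
    where
    v≢u′ : v ≢ u′
    v≢u′ refl = vw≰u′ (x∧ᵥy≤ᵥx v w)

    u′≤v∨w : u′ ≤ᵥ v ∨ᵥ w
    u′≤v∨w = [ ⊥-elim ∘ vw≰u′ , id ]′ (face-triangle F-face u′∈F v∈F w∈F v≢w)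

    vw≤u : v ∧ᵥ w ≤ᵥ u
    vw≤u = [ id , ⊥-elim ∘ u≰v∨w ]′ (face-triangle F-face u∈F v∈F w∈F v≢w)

    u≤v∨u′-absurd : ¬ (u ≤ᵥ v ∨ᵥ u′)
    u≤v∨u′-absurd u≤v∨u′ = u≰v∨w (subst (u ≤ᵥ_) v∨u′≡v∨w u≤v∨u′)
      where
      v∨u′≡v∨w : v ∨ᵥ u′ ≡ v ∨ᵥ w
      v∨u′≡v∨w = ≤ᵥ∧Σᵥ≡⇒≡ (∨ᵥ-lub (x≤ᵥx∨ᵥy v w) u′≤v∨w)
                   (trans (proj₂ (face-⋖join F-face v∈F u′∈F v≢u′))
                          (sym (proj₂ (face-⋖join F-face v∈F w∈F v≢w))))

    vu′≤u-absurd : ¬ (v ∧ᵥ u′ ≤ᵥ u)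
    vu′≤u-absurd vu′≤u with (v ∧ᵥ u′) ≟ᵥ (v ∧ᵥ w)
    ... | yes vu′≡vw = vw≰u′ (subst (_≤ᵥ u′) vu′≡vw (x∧ᵥy≤ᵥy v u′))
    ... | no  vu′≢vw = u≰v∨w (subst (_≤ᵥ v ∨ᵥ w) v≡u (x≤ᵥx∨ᵥy v w))
      where
      v≤u : v ≤ᵥ u
      v≤u = subst (_≤ᵥ u) (⋖-join (face-meet⋖ F-face v∈F u′∈F v≢u′) (face-meet⋖ F-face v∈F w∈F v≢w) vu′≢vw)
                  (∨ᵥ-lub vu′≤u vw≤u)
      v≡u : v ≡ u
      v≡u = ≤ᵥ∧Σᵥ≡⇒≡ v≤u (face-level F-face v∈F u∈F)

  face-above-meet⊎below-join : IsFace F → v ∈ F → w ∈ F → v ≢ w →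
    (∀ {u} → u ∈ F → v ∧ᵥ w ≤ᵥ u) ⊎ (∀ {u} → u ∈ F → u ≤ᵥ v ∨ᵥ w)
  face-above-meet⊎below-join {F = F} {v} {w} F-face v∈F w∈F v≢w with All.all? (v ∧ᵥ w ≤ᵥ?_) F
  ... | yes all-above = inj₁ (All.lookup all-above)
  ... | no  ¬all-above =
    let u′ , u′∈F , vw≰u′ = find (Allₚ.¬All⇒Any¬ (v ∧ᵥ w ≤ᵥ?_) F ¬all-above) in
    inj₂ λ u∈F → decidable-stable (_ ≤ᵥ? v ∨ᵥ w) (face-no-crossing F-face v∈F w∈F v≢w u∈F u′∈F vw≰u′)

  PosSubface NegSubface : List (Pt n) → Set
  PosSubface F = ∃ λ p → Σℤ p ≡ -[1+ 0 ] × F ⊆ posSet p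
  NegSubface F = ∃ λ q → Σℤ q ≡ + 1 × F ⊆ negSet q

  edge-classification : IsFace F → v ∈ F → w ∈ F → v ≢ w → PosSubface F ⊎ NegSubface F
  edge-classification {F = F} {v = v} {w} F-face v∈F w∈F v≢w =
    [ (λ above → inj₁ (v ∧ᵥ w , Σp≡-1 , λ {u} u∈F → from ∈posSet⇔ (above u∈F , Σu≡ u∈F)))
    , (λ below → inj₂ (v ∨ᵥ w , Σq≡1 , λ {u} u∈F → from ∈negSet⇔ (below u∈F , Σq≡ u∈F)))
    ]′ (face-above-meet⊎below-join F-face v∈F w∈F v≢w)
    where
    vw⋖v : v ∧ᵥ w ⋖ v
    vw⋖v = face-meet⋖ F-face v∈F w∈F v≢w
    v⋖v∨w : v ⋖ v ∨ᵥ w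
    v⋖v∨w = face-⋖join F-face v∈F w∈F v≢w
    Σp≡-1 : Σℤ (v ∧ᵥ w) ≡ -[1+ 0 ]
    Σp≡-1 = ℤ-suc-injective (trans (sym (proj₂ vw⋖v)) (face-InA F-face v∈F))
    Σq≡1 : Σℤ (v ∨ᵥ w) ≡ + 1
    Σq≡1 = trans (proj₂ v⋖v∨w) (cong ℤ.suc (face-InA F-face v∈F))
    Σu≡ : u ∈ F → Σℤ u ≡ ℤ.suc (Σℤ (v ∧ᵥ w))
    Σu≡ u∈F = trans (face-level F-face u∈F v∈F) (proj₂ vw⋖v)
    Σq≡ : u ∈ F → Σℤ (v ∨ᵥ w) ≡ ℤ.suc (Σℤ u)
    Σq≡ u∈F = trans (proj₂ v⋖v∨w) (cong ℤ.suc (face-level F-face v∈F u∈F))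

  face-classification : IsFace F → PosSubface F ⊎ NegSubface F
  face-classification {[]}    (_ , F≢[] , _) = ⊥-elim (F≢[] refl)
  face-classification {v ∷ []} F-face =
    inj₁ (v -ᵥ e zero , Σp≡-1 , λ { (here refl) → from ∈posSet⇔ (x-eᵢ⋖x v zero) })
    where
    Σp≡-1 : Σℤ (v -ᵥ e zero) ≡ -[1+ 0 ]
    Σp≡-1 = ℤ-suc-injective (trans (sym (proj₂ (x-eᵢ⋖x v zero))) (face-InA F-face (here refl)))
  face-classification {v ∷ w ∷ _} F-face@((v∉ ∷ _) , _) =
    edge-classification F-face (here refl) (there (here refl)) (All.head v∉)

  length-posSet : (p : Pt n) → length (posSet p) ≡ suc n
  length-posSet p = length-toList-tabulate (λ i → p +ᵥ e i)

  length-negSet : (q : Pt n) → length (negSet q) ≡ suc n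
  length-negSet q = length-toList-tabulate (λ i → q -ᵥ e i)

  face-length≤ : IsFace F → length F ≤ suc n
  face-length≤ F-face@(F-uniq , _) with face-classification F-face
  ... | inj₁ (p , _ , F⊆) = ℕP.≤-trans (Unique⇒length≤ F-uniq F⊆) (ℕP.≤-reflexive (length-posSet p))
  ... | inj₂ (q , _ , F⊆) = ℕP.≤-trans (Unique⇒length≤ F-uniq F⊆) (ℕP.≤-reflexive (length-negSet q))

  face∧length≥⇒facet : IsFace F → suc n ≤ length F → IsFacet F
  face∧length≥⇒facet F-face@(F-uniq , _) n<|F| = F-face , λ G G-face F⊆G →
    Unique∧length≥⇒⊇ _≟ᵥ_ F-uniq F⊆G (ℕP.≤-trans (face-length≤ G-face) n<|F|)

  posSet-face : Σℤ p ≡ -[1+ 0 ] → IsFace (posSet p)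
  posSet-face {p} Σp≡-1 = posSet-Unique p , ∈⇒≢[] (∈-toList-tabulate⁺ (λ i → p +ᵥ e i) zero)
    , All.tabulate InA-of , λ x∈ y∈ x≢y →
      from (dist≡1⇔meet⋖ (trans (InA-of x∈) (sym (InA-of y∈))))
           (subst (_⋖ _) (sym (⋖-meet (to ∈posSet⇔ x∈) (to ∈posSet⇔ y∈) x≢y)) (to ∈posSet⇔ x∈))
    where
    InA-of : x ∈ posSet p → InA x
    InA-of x∈ = trans (proj₂ (to ∈posSet⇔ x∈)) (cong ℤ.suc Σp≡-1)

  negSet-face : Σℤ q ≡ + 1 → IsFace (negSet q)
  negSet-face {q} Σq≡1 = negSet-Unique q , ∈⇒≢[] (∈-toList-tabulate⁺ (λ i → q -ᵥ e i) zero)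
    , All.tabulate InA-of , λ x∈ y∈ x≢y →
      let Σx≡Σy = trans (InA-of x∈) (sym (InA-of y∈)) in
      from (dist≡1⇔meet⋖ Σx≡Σy)
           (from (meet⋖⇔⋖join Σx≡Σy)
                 (subst (_ ⋖_) (sym (⋖-join (to ∈negSet⇔ x∈) (to ∈negSet⇔ y∈) x≢y)) (to ∈negSet⇔ x∈)))
    where
    InA-of : x ∈ negSet q → InA x
    InA-of x∈ = ℤ-suc-injective (trans (sym (proj₂ (to ∈negSet⇔ x∈))) Σq≡1)

  posSet-facet : Σℤ p ≡ -[1+ 0 ] → IsFacet (posSet p)
  posSet-facet {p} Σp≡-1 = face∧length≥⇒facet (posSet-face Σp≡-1) (ℕP.≤-reflexive (sym (length-posSet p)))

  negSet-facet : Σℤ q ≡ + 1 → IsFacet (negSet q)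
  negSet-facet {q} Σq≡1 = face∧length≥⇒facet (negSet-face Σq≡1) (ℕP.≤-reflexive (sym (length-negSet q)))

  facet-resp-≋ : Unique F → F ≋ G → IsFacet G → IsFacet F
  facet-resp-≋ {F = F} {G = G} F-uniq (F⊆G , G⊆F) ((_ , G≢[] , G-InA , adjacent) , G-maximal) =
    (F-uniq , F≢[] , All.tabulate (All.lookup G-InA ∘ F⊆G) , λ x∈ y∈ → adjacent (F⊆G x∈) (F⊆G y∈)) ,
    λ H H-face F⊆H → G⊆F ∘ G-maximal H H-face (F⊆H ∘ G⊆F)
    where
    F≢[] : F ≢ []
    F≢[] refl = G≢[] (⊆[]⇒≡[] G⊆F)

  facet⇒form : IsFacet F → PosForm F ⊎ NegForm F
  facet⇒form (F-face , F-maximal) with face-classification F-face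
  ... | inj₁ (p , Σp≡-1 , F⊆) = inj₁ (p , Σp≡-1 , F⊆ , F-maximal _ (posSet-face Σp≡-1) F⊆)
  ... | inj₂ (q , Σq≡1 , F⊆)  = inj₂ (q , Σq≡1 , F⊆ , F-maximal _ (negSet-face Σq≡1) F⊆)

  form⇒facet : Unique F → PosForm F ⊎ NegForm F → IsFacet F
  form⇒facet F-uniq (inj₁ (p , Σp≡-1 , F≋)) = facet-resp-≋ F-uniq F≋ (posSet-facet Σp≡-1)
  form⇒facet F-uniq (inj₂ (q , Σq≡1 , F≋))  = facet-resp-≋ F-uniq F≋ (negSet-facet Σq≡1)

  face⊆facet : IsFace F → Σ (List (Pt n)) λ G → IsFacet G × F ⊆ G
  face⊆facet F-face with face-classification F-face
  ... | inj₁ (p , Σp≡-1 , F⊆) = posSet p , posSet-facet Σp≡-1 , F⊆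
  ... | inj₂ (q , Σq≡1 , F⊆)  = negSet q , negSet-facet Σq≡1 , F⊆

  ≋-sym : F ≋ G → G ≋ F
  ≋-sym (F⊆G , G⊆F) = G⊆F , F⊆G

  ≋-trans : F ≋ G → G ≋ H → F ≋ H
  ≋-trans (F⊆G , G⊆F) (G⊆H , H⊆G) = G⊆H ∘ F⊆G , G⊆F ∘ H⊆G

  apex-posSet : G ≋ posSet p → F ⊆ G → x ∈ F → p ⋖ x
  apex-posSet (G⊆ , _) F⊆G x∈F = to ∈posSet⇔ (G⊆ (F⊆G x∈F))

  apex-negSet : G ≋ negSet q → F ⊆ G → x ∈ F → x ⋖ q
  apex-negSet (G⊆ , _) F⊆G x∈F = to ∈negSet⇔ (G⊆ (F⊆G x∈F))

  facets-through-triangle : a ∈ F → b ∈ F → c ∈ F → a ≢ b → a ≢ c → b ≢ c →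
                            IsFacet G → IsFacet H → F ⊆ G → F ⊆ H → G ≋ H
  facets-through-triangle {H = H} a∈F b∈F c∈F a≢b a≢c b≢c G-facet H-facet F⊆G F⊆H
    with facet⇒form G-facet | facet⇒form H-facet
  ... | inj₁ (p , _ , G≋) | inj₁ (p′ , _ , H≋) =
    ≋-trans G≋ (subst (λ r → posSet r ≋ H) (sym p≡p′) (≋-sym H≋))
    where
    p≡p′ : p ≡ p′
    p≡p′ = trans (sym (⋖-meet (apex-posSet G≋ F⊆G a∈F) (apex-posSet G≋ F⊆G b∈F) a≢b))
                 (⋖-meet (apex-posSet H≋ F⊆H a∈F) (apex-posSet H≋ F⊆H b∈F) a≢b)
  ... | inj₂ (q , _ , G≋) | inj₂ (q′ , _ , H≋) =
    ≋-trans G≋ (subst (λ r → negSet r ≋ H) (sym q≡q′) (≋-sym H≋))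
    where
    q≡q′ : q ≡ q′
    q≡q′ = trans (sym (⋖-join (apex-negSet G≋ F⊆G a∈F) (apex-negSet G≋ F⊆G b∈F) a≢b))
                 (⋖-join (apex-negSet H≋ F⊆H a∈F) (apex-negSet H≋ F⊆H b∈F) a≢b)
  ... | inj₁ (_ , _ , G≋) | inj₂ (_ , _ , H≋) = ⊥-elim (⋖-triangle-absurd a≢b a≢c b≢c
    (apex-posSet G≋ F⊆G a∈F) (apex-posSet G≋ F⊆G b∈F) (apex-posSet G≋ F⊆G c∈F)
    (apex-negSet H≋ F⊆H a∈F) (apex-negSet H≋ F⊆H b∈F) (apex-negSet H≋ F⊆H c∈F))
  ... | inj₂ (_ , _ , G≋) | inj₁ (_ , _ , H≋) = ⊥-elim (⋖-triangle-absurd a≢b a≢c b≢c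
    (apex-posSet H≋ F⊆H a∈F) (apex-posSet H≋ F⊆H b∈F) (apex-posSet H≋ F⊆H c∈F)
    (apex-negSet G≋ F⊆G a∈F) (apex-negSet G≋ F⊆G b∈F) (apex-negSet G≋ F⊆G c∈F))

  facet-unique : IsFace F → 2 ≤ dim F → ∀ G H → IsFacet G → IsFacet H → F ⊆ G → F ⊆ H → G ≋ H
  facet-unique {a ∷ b ∷ c ∷ _} ((a∉ ∷ b∉ ∷ _) , _) _ _ _ =
    facets-through-triangle (here refl) (there (here refl)) (there (there (here refl)))
                            (All.head a∉) (All.head (All.tail a∉)) (All.head b∉)
  facet-unique {_ ∷ _ ∷ []} _ (s≤s ())

  positive-facets-at : InA v → ExactlyK (suc n) (λ F → PositiveFacet F × v ∈ F)
  positive-facets-at {v} v∈A =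
    List.tabulate facet , Listₚ.length-tabulate facet , Allₚ.tabulate⁺ facet-at ,
    AllPairsₚ.tabulate⁺ distinct , complete
    where
    facet : Fin (suc n) → List (Pt n)
    facet i = posSet (v -ᵥ e i)
    Σ≡-1 : ∀ i → Σℤ (v -ᵥ e i) ≡ -[1+ 0 ]
    Σ≡-1 i = ℤ-suc-injective (trans (sym (proj₂ (x-eᵢ⋖x v i))) v∈A)
    facet-at : ∀ i → PositiveFacet (facet i) × v ∈ facet i
    facet-at i = (posSet-facet (Σ≡-1 i) , v -ᵥ e i , Σ≡-1 i , id , id) , from ∈posSet⇔ (x-eᵢ⋖x v i)
    distinct : ∀ {i j} → i ≢ j → ¬ (facet i ≋ facet j)
    distinct i≢j facetᵢ≋facetⱼ = i≢j (x-eᵢ-injective v (posSet-injective facetᵢ≋facetⱼ))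
    complete : ∀ F → PositiveFacet F × v ∈ F → Any (F ≋_) (List.tabulate facet)
    complete F ((_ , x , _ , F≋) , v∈F) =
      let i , x≡v-eᵢ = ∈-toList-tabulate⁻ (λ i → v -ᵥ e i) (from ∈negSet⇔ (to ∈posSet⇔ (proj₁ F≋ v∈F)))
      in  Anyₚ.tabulate⁺ {f = facet} i (subst (λ r → F ≋ posSet r) x≡v-eᵢ F≋)

  negative-facets-at : InA v → ExactlyK (suc n) (λ F → NegativeFacet F × v ∈ F)
  negative-facets-at {v} v∈A =
    List.tabulate facet , Listₚ.length-tabulate facet , Allₚ.tabulate⁺ facet-at ,
    AllPairsₚ.tabulate⁺ distinct , complete
    where
    facet : Fin (suc n) → List (Pt n)
    facet i = negSet (v +ᵥ e i)
    Σ≡1 : ∀ i → Σℤ (v +ᵥ e i) ≡ + 1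
    Σ≡1 i = trans (proj₂ (x⋖x+eᵢ v i)) (cong ℤ.suc v∈A)
    facet-at : ∀ i → NegativeFacet (facet i) × v ∈ facet i
    facet-at i = (negSet-facet (Σ≡1 i) , v +ᵥ e i , Σ≡1 i , id , id) , from ∈negSet⇔ (x⋖x+eᵢ v i)
    distinct : ∀ {i j} → i ≢ j → ¬ (facet i ≋ facet j)
    distinct i≢j facetᵢ≋facetⱼ = i≢j (x+eᵢ-injective v (negSet-injective facetᵢ≋facetⱼ))
    complete : ∀ F → NegativeFacet F × v ∈ F → Any (F ≋_) (List.tabulate facet)
    complete F ((_ , x , _ , F≋) , v∈F) =
      let i , x≡v+eᵢ = ∈-toList-tabulate⁻ (λ i → v +ᵥ e i) (from ∈posSet⇔ (to ∈negSet⇔ (proj₁ F≋ v∈F)))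
      in  Anyₚ.tabulate⁺ {f = facet} i (subst (λ r → F ≋ negSet r) x≡v+eᵢ F≋)

  dimension : HasDimension n n
  dimension = (λ F F-face → ℕP.∸-monoˡ-≤ 1 (face-length≤ F-face)) ,
              posSet p₀ , posSet-face {p₀} Σp₀≡-1 , cong (ℕ._∸ 1) (length-posSet p₀)
    where
    p₀ : Pt n
    p₀ = 0ᵥ -ᵥ e zero
    Σp₀≡-1 : Σℤ p₀ ≡ -[1+ 0 ]
    Σp₀≡-1 = ℤ-suc-injective (trans (sym (proj₂ (x-eᵢ⋖x {n} 0ᵥ zero))) (Σᵥ-0ᵥ {suc n}))

lemma4p3 : (n : ℕ) →
  HasDimension n n
  × (∀ (F : List (Pt n)) → Unique F → (IsFacet F ⇔ (PosForm F ⊎ NegForm F)))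
  × (∀ (v : Pt n) → InA v →
       ExactlyK (suc n) (λ F → PositiveFacet F × v ∈ F)
       × ExactlyK (suc n) (λ F → NegativeFacet F × v ∈ F))
  × (∀ (F : List (Pt n)) → IsFace F →
       (Σ (List (Pt n)) λ G → IsFacet G × F ⊆ G)
       × (2 ≤ dim F → ∀ G H → IsFacet G → IsFacet H → F ⊆ G → F ⊆ H → G ≋ H))
lemma4p3 n =
  dimension ,
  (λ F F-uniq → mk⇔ facet⇒form (form⇒facet F-uniq)) ,
  (λ v v∈A → positive-facets-at v∈A , negative-facets-at v∈A) ,
  (λ F F-face → face⊆facet F-face , facet-unique F-face)
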